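{- Suppose $k \geq 2$ and $d_1, \ldots, d_k$ are positive integers with $d_1 \leq d_i$ for each $i \in \{1,\dots,k\}$. Let $l$ be a nonnegative integer with $l \leq d_1 -1$, and let $A_l$ be the set of all $k$-tuples $(a_1, \ldots, a_k)$ of nonnegative integers with $\sum_{i=1}^{k}a_i = l$. Then $$(d_1-l) \prod_{i=2}^{k}d_i \leq \prod_{i=1}^{k}(d_i-a_i)$$ for each $(a_1, \ldots, a_k)\in A_l$. -}

module Defs where

open import Data.Nat using (ℕ; zero; suc; _+_; _*_)
open import Data.Fin using (Fin; zero; suc)

∑ : (n : ℕ) → (Fin n → ℕ) → ℕ
∑ zero    f = 0
∑ (suc n) f = f zero + ∑ n (λ i → f (suc i))

∏ : (n : ℕ) → (Fin n → ℕ) → ℕ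
∏ zero    f = 1
∏ (suc n) f = f zero * ∏ n (λ i → f (suc i))

{-# OPTIONS --safe #-}
-- Subtracting b from the larger of two factors u ≤ e costs less than subtracting it from the
-- smaller one: e (u − b) ≤ u (e − b). Starting from (d₁ − l) ∏ dᵢ with l = ∑ aᵢ, move the
-- deficits aᵢ (i ≥ 2) one at a time from the factor d₁ − … onto the factor dᵢ ≥ d₁.
module Submission where

open import Defs
open import Data.Nat using (ℕ; zero; suc; _≤_; _∸_; _*_; _+_)
open import Data.Nat.Properties
open import Data.Fin using (Fin; zero; suc)
open import Relation.Binary.PropositionalEquality using (_≡_; refl; sym; cong)
open import Algebra.Properties.CommutativeSemigroup *-commutativeSemigroup using (x∙yz≈y∙xz)

m≤n⇒n*[m∸o]≤m*[n∸o] : ∀ {m n} o → m ≤ n → n * (m ∸ o) ≤ m * (n ∸ o)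
m≤n⇒n*[m∸o]≤m*[n∸o] {m} {n} o m≤n = begin
  n * (m ∸ o)      ≡⟨ *-distribˡ-∸ n m o ⟩
  n * m ∸ n * o    ≤⟨ ∸-monoʳ-≤ (n * m) (*-monoˡ-≤ o m≤n) ⟩
  n * m ∸ m * o    ≡⟨ cong (_∸ m * o) (*-comm n m) ⟩
  m * n ∸ m * o    ≡⟨ *-distribˡ-∸ m n o ⟨
  m * (n ∸ o)      ∎
  where open ≤-Reasoning

[x∸[c+∑a]]*∏e≤[x∸c]*∏[e∸a] : ∀ n x c (e a : Fin n → ℕ) → (∀ i → x ≤ e i) →
                            (x ∸ (c + ∑ n a)) * ∏ n e ≤ (x ∸ c) * ∏ n (λ i → e i ∸ a i)
[x∸[c+∑a]]*∏e≤[x∸c]*∏[e∸a] zero    x c e a x≤e = ≤-reflexive (cong (λ t → (x ∸ t) * 1) (+-identityʳ c))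
[x∸[c+∑a]]*∏e≤[x∸c]*∏[e∸a] (suc n) x c e a x≤e = begin
  (x ∸ (c + (a₀ + S))) * (e₀ * P)  ≡⟨ x∙yz≈y∙xz (x ∸ (c + (a₀ + S))) e₀ P ⟩
  e₀ * ((x ∸ (c + (a₀ + S))) * P)  ≡⟨ cong (λ t → e₀ * ((x ∸ t) * P)) (+-assoc c a₀ S) ⟨
  e₀ * ((x ∸ (c + a₀ + S)) * P)    ≤⟨ *-monoʳ-≤ e₀ moveTail ⟩
  e₀ * ((x ∸ (c + a₀)) * Q)        ≡⟨ *-assoc e₀ (x ∸ (c + a₀)) Q ⟨
  e₀ * (x ∸ (c + a₀)) * Q          ≡⟨ cong (λ t → e₀ * t * Q) (∸-+-assoc x c a₀) ⟨
  e₀ * (x ∸ c ∸ a₀) * Q            ≤⟨ *-monoˡ-≤ Q moveHead ⟩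
  (x ∸ c) * (e₀ ∸ a₀) * Q          ≡⟨ *-assoc (x ∸ c) (e₀ ∸ a₀) Q ⟩
  (x ∸ c) * ((e₀ ∸ a₀) * Q)        ∎
  where
  open ≤-Reasoning
  a₀ = a zero
  e₀ = e zero
  S = ∑ n (λ i → a (suc i))
  P = ∏ n (λ i → e (suc i))
  Q = ∏ n (λ i → e (suc i) ∸ a (suc i))

  moveTail : (x ∸ (c + a₀ + S)) * P ≤ (x ∸ (c + a₀)) * Q
  moveTail = [x∸[c+∑a]]*∏e≤[x∸c]*∏[e∸a] n x (c + a₀) (λ i → e (suc i)) (λ i → a (suc i)) (λ i → x≤e (suc i))

  moveHead : e₀ * (x ∸ c ∸ a₀) ≤ (x ∸ c) * (e₀ ∸ a₀)
  moveHead = m≤n⇒n*[m∸o]≤m*[n∸o] a₀ (≤-trans (m∸n≤m x c) (x≤e zero))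

-- With truncated subtraction the inequality holds without the hypotheses k ≥ 2, dᵢ ≥ 1 and l < d₁.
lemma19 : (m : ℕ) → 2 ≤ suc m →
          (d : Fin (suc m) → ℕ) → (∀ i → 1 ≤ d i) → (∀ i → d zero ≤ d i) →
          (l : ℕ) → l ≤ d zero ∸ 1 →
          (a : Fin (suc m) → ℕ) → ∑ (suc m) a ≡ l →
          (d zero ∸ l) * ∏ m (λ j → d (suc j)) ≤ ∏ (suc m) (λ i → d i ∸ a i)
lemma19 m _ d _ d₁≤d l _ a refl =
  [x∸[c+∑a]]*∏e≤[x∸c]*∏[e∸a] m (d zero) (a zero) (λ j → d (suc j)) (λ j → a (suc j)) (λ j → d₁≤d (suc j))
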